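{- Let $2\le k\le n$ and let $\sigma_t$ be an assignment with $\sigma_t^T(o_1)=k$ and $\sigma_t^T(o_n)=k-1$. If $\sigma_t$ is compatible, then $\sigma_t$ is reachable.
   Context: Agents $N=\{1,\dots,n\}$ lie on a path in this order; objects $O=\{o_1,\dots,o_n\}$; each agent $i$ has a strict preference $\succ_i$ (a linear order on $O$); the initial assignment is $\sigma_0(i)=o_i$. A swap exchanges the objects of two adjacent agents and is allowed only if both strictly prefer the object they receive; an assignment is reachable if obtained from $\sigma_0$ by a finite sequence of allowed swaps. $\sigma^T(o)$ is the agent holding $o$ in $\sigma$; $[x,y]$ is the set of integers between $x$ and $y$ inclusive, regardless of order. For an assignment $\sigma_t$ with $\sigma_t^T(o_1)=k$, $\sigma_t^T(o_n)=k-1$ and objects $o_a,o_b$ with $a<b$, put $a'=\sigma_t^T(o_a)$, $b'=\sigma_t^T(o_b)$, $Q=[a,a']\cap[b,b']$. The pair is intersected if $Q\neq\emptyset$. The pair is compatible if it is not intersected, or it is intersected and one of the following holds: (1) $a'>a$, $b'>b$, $a'<b'$ and $o_a\succ_q o_b$ for all $q\in Q$; (2) $a'<a$, $b'<b$, $a'<b'$ and $o_b\succ_q o_a$ for all $q\in Q$; (3) $a'>a$, $b'<b$, $c:=a'+b'-k+1\in Q\setminus\{a\}$, $o_b\succ_q o_a$ for all $\max(a,b')\le q<c$, and $o_a\succ_q o_b$ for all $c\le q\le\min(a',b)$. The assignment $\sigma_t$ is compatible if $\sigma_t(i)\neq o_i$ for every agent $i$ and every pair of objects is compatible. -}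

module Defs where

open import Data.Nat using (ℕ; zero; suc; _+_; _∸_; _≤_; _<_; _⊔_; _⊓_)
open import Data.Fin using (Fin; toℕ; inject₁; fromℕ)
import Data.Fin as F
open import Data.Fin.Permutation using (Permutation′; _⟨$⟩ʳ_; _⟨$⟩ˡ_; transpose)
open import Data.Product using (Σ; ∃; _×_; _,_)
open import Data.Sum using (_⊎_)
open import Relation.Nullary using (¬_)
open import Relation.Binary.PropositionalEquality using (_≡_; _≢_)

-- Agents and objects are both indexed by Fin n (0-based); the paper's
-- 1-based index of x is  idx x = toℕ x + 1.  Agent i lies on the path in
-- index order; object o_j is the element of Fin n with idx = j.
idx : {n : ℕ} → Fin n → ℕ
idx x = suc (toℕ x)

-- A strict preference profile: each agent i has a linear order on objects,
-- given by a ranking permutation (rank 0 = most preferred).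
Pref : ℕ → Set
Pref n = Fin n → Permutation′ n

prefers : {n : ℕ} → Pref n → Fin n → Fin n → Fin n → Set
prefers P i o o' = toℕ (P i ⟨$⟩ʳ o) < toℕ (P i ⟨$⟩ʳ o')

-- An assignment is a bijection from agents to objects.
-- σ ⟨$⟩ʳ i = σ(i) ;  σ ⟨$⟩ˡ o = σ^T(o).
Assignment : ℕ → Set
Assignment n = Permutation′ n

SwapStep : {m : ℕ} → Pref (suc m) → Assignment (suc m) → Assignment (suc m) → Set
SwapStep {m} P σ τ = Σ (Fin m) λ j →
    prefers P (inject₁ j) (σ ⟨$⟩ʳ F.suc j) (σ ⟨$⟩ʳ inject₁ j)
  × prefers P (F.suc j) (σ ⟨$⟩ʳ inject₁ j) (σ ⟨$⟩ʳ F.suc j)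
  × (∀ i → τ ⟨$⟩ʳ i ≡ σ ⟨$⟩ʳ (transpose (inject₁ j) (F.suc j) ⟨$⟩ʳ i))

data Reachable {m : ℕ} (P : Pref (suc m)) : Assignment (suc m) → Set where
  initial : (σ : Assignment (suc m)) → (∀ i → σ ⟨$⟩ʳ i ≡ i) → Reachable P σ
  step    : (σ τ : Assignment (suc m)) → Reachable P σ → SwapStep P σ τ → Reachable P τ

_∈[_,_] : ℕ → ℕ → ℕ → Set
q ∈[ x , y ] = (x ≤ q × q ≤ y) ⊎ (y ≤ q × q ≤ x)

module _ {n : ℕ} (P : Pref n) (σ : Assignment n) (k : ℕ) (oa ob : Fin n) where
  private
    a  = idx oa
    b  = idx ob
    a' = idx (σ ⟨$⟩ˡ oa)
    b' = idx (σ ⟨$⟩ˡ ob)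

  InQ : ℕ → Set
  InQ q = q ∈[ a , a' ] × q ∈[ b , b' ]

  Intersected : Set
  Intersected = ∃ λ q → InQ q

  Cond1 : Set
  Cond1 = a < a' × b < b' × a' < b'
        × (∀ (q : Fin n) → InQ (idx q) → prefers P q oa ob)

  Cond2 : Set
  Cond2 = a' < a × b' < b × a' < b'
        × (∀ (q : Fin n) → InQ (idx q) → prefers P q ob oa)

  -- c := a' + b' - k + 1, expressed without truncated subtraction as
  -- c + k = a' + b' + 1 (c ∈ Q forces c ≥ 1, so c is the integer value).
  Cond3 : Set
  Cond3 = a < a' × b' < b
        × Σ ℕ λ c → c + k ≡ a' + b' + 1 × InQ c × c ≢ a
          × (∀ (q : Fin n) → a ⊔ b' ≤ idx q → idx q < c → prefers P q ob oa)
          × (∀ (q : Fin n) → c ≤ idx q → idx q ≤ a' ⊓ b → prefers P q oa ob)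

  PairCompatible : Set
  PairCompatible = ¬ Intersected ⊎ (Intersected × (Cond1 ⊎ Cond2 ⊎ Cond3))

Compatible : {n : ℕ} → Pref n → Assignment n → ℕ → Set
Compatible {n} P σ k =
    (∀ (i : Fin n) → σ ⟨$⟩ʳ i ≢ i)
  × (∀ (oa ob : Fin n) → toℕ oa < toℕ ob → PairCompatible P σ k oa ob)

{-# OPTIONS --safe #-}
-- Let K = k − 1, so agent K holds o_n.  For an inversion of σ (objects o_a < o_b held by agents
-- b' < a') the intervals [a,a'] and [b,b'] meet, so compatibility leaves only condition (3), and
-- its crossing point c = a' + b' − k + 1 lies in [b',a']; this forces b' ≤ K ≤ a'.  An inversion
-- among agents 1..K would thus involve agent K, whose object o_n is maximal, and there is none
-- among agents K+1..n: both halves of the path hold increasing objects, so the path is a riffle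
-- shuffle of o_1 … o_n.  Starting from σ₀, move every object of the right half rightwards past
-- the larger objects of the left half; counting from 0, the i-th right object meets the j-th left
-- one at agents i+j+1, i+j+2, where condition (3), with c = i+j+2, says both agents want the swap.
module Submission where

open import Defs
open import Data.Nat using (ℕ; suc; _≤_; _∸_)
open import Data.Fin using (zero; fromℕ)
open import Data.Fin.Permutation using (_⟨$⟩ˡ_)
open import Relation.Binary.PropositionalEquality using (_≡_)

open import Data.Nat using (zero; _+_; _<_; _⊔_; _⊓_; z≤n; s≤s; s≤s⁻¹; s<s⁻¹)
open import Data.Nat.Properties hiding (_≟_)
open import Data.Nat.Tactic.RingSolver using (solve-∀)
open import Data.Fin as F using (Fin; toℕ; fromℕ<; inject₁; _≟_)
import Data.Fin.Properties as F
open import Data.Fin.Permutation using (_⟨$⟩ʳ_; transpose; _∘ₚ_; inverseˡ; inverseʳ)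
import Data.Fin.Permutation as Perm
open import Data.List using (List; []; _∷_; _++_; _∷ʳ_; length; take; drop; tabulate; allFin; filter)
open import Data.List.Properties using (length-++; ∷ʳ-++; take++drop≡id; length-tabulate)
open import Data.List.Membership.Propositional using (_∈_)
open import Data.List.Membership.Propositional.Properties using (∈-filter⁺; ∈-filter⁻; ∈-++⁺ˡ; ∈-++⁻; ∈-tabulate⁺; ∈-allFin)
open import Data.List.Relation.Unary.All using (All; []; _∷_)
import Data.List.Relation.Unary.All as All
open import Data.List.Relation.Unary.Any using (here; there)
open import Data.List.Relation.Unary.AllPairs using (AllPairs; []; _∷_)
import Data.List.Relation.Unary.AllPairs.Properties as AllPairs
open import Data.List.Relation.Binary.Subset.Propositional using (_⊆_)
open import Data.List.Relation.Binary.Disjoint.Propositional using (Disjoint)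
open import Data.List.Relation.Binary.Permutation.Propositional using (↭-sym)
open import Data.List.Relation.Binary.Permutation.Propositional.Properties using (∈-resp-↭)
open import Data.List.Relation.Ternary.Interleaving.Propositional using (Interleaving; []; consˡ; consʳ; toPermutation)
import Data.List.Relation.Ternary.Interleaving.Propositional.Properties as Interleaving
open import Data.Product as Product using (∃; _×_; _,_; proj₁; proj₂; map₂)
open import Data.Sum as Sum using (_⊎_; inj₁; inj₂)
open import Data.Empty using (⊥-elim)
open import Function using (_∘_; id)
open import Relation.Nullary using (yes; no; ¬?)
open import Relation.Binary using (Asymmetric; DecidableEquality; tri<; tri≈; tri>)
open import Relation.Binary.PropositionalEquality
  using (_≢_; refl; sym; trans; cong; cong₂; subst; subst₂; module ≡-Reasoning)

private variable
  A : Set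
  x y z : A
  xs ys zs : List A
  p q : ℕ

infix 4 _[_]=_

data _[_]=_ {A : Set} : List A → ℕ → A → Set where
  here  : (x ∷ xs) [ 0 ]= x
  there : xs [ p ]= y → (x ∷ xs) [ suc p ]= y

[]=-functional : xs [ p ]= x → xs [ p ]= y → x ≡ y
[]=-functional here      here      = refl
[]=-functional (there a) (there b) = []=-functional a b

[]=-cong : p ≡ q → x ≡ y → xs [ p ]= x → xs [ q ]= y
[]=-cong refl refl a = a

[]=⇒< : xs [ p ]= x → p < length xs
[]=⇒< here      = s≤s z≤n
[]=⇒< (there a) = s≤s ([]=⇒< a)

[]=⇒∈ : xs [ p ]= x → x ∈ xs
[]=⇒∈ here      = here refl
[]=⇒∈ (there a) = there ([]=⇒∈ a)

∈⇒[]= : x ∈ xs → ∃ λ p → xs [ p ]= x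
∈⇒[]= (here refl) = 0 , here
∈⇒[]= (there x∈xs) with p , a ← ∈⇒[]= x∈xs = suc p , there a

[]=-++-∷ : ∀ xs → (xs ++ x ∷ ys) [ length xs ]= x
[]=-++-∷ []       = here
[]=-++-∷ (_ ∷ xs) = there ([]=-++-∷ xs)

[]=-++-∷-∷ : ∀ xs → (xs ++ x ∷ y ∷ ys) [ suc (length xs) ]= y
[]=-++-∷-∷ []       = there here
[]=-++-∷-∷ (_ ∷ xs) = there ([]=-++-∷-∷ xs)

[]=-swap-other : ∀ xs → (xs ++ x ∷ y ∷ ys) [ p ]= z → p ≢ length xs → p ≢ suc (length xs)
  → (xs ++ y ∷ x ∷ ys) [ p ]= z
[]=-swap-other []       here              p≢0 _   = ⊥-elim (p≢0 refl)
[]=-swap-other []       (there here)      _   p≢1 = ⊥-elim (p≢1 refl)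
[]=-swap-other []       (there (there a)) _   _   = there (there a)
[]=-swap-other (_ ∷ xs) here              _   _   = here
[]=-swap-other (_ ∷ xs) (there a)         p≢d p≢d+1 =
  there ([]=-swap-other xs a (p≢d ∘ cong suc) (p≢d+1 ∘ cong suc))

all-[]= : ∀ {P : A → Set} xs → (∀ {p y} → xs [ p ]= y → P y) → All P xs
all-[]= []       _ = []
all-[]= (x ∷ xs) h = h here ∷ all-[]= xs (h ∘ there)

allPairs-[]= : ∀ {R : A → A → Set} xs → (∀ {p q x y} → p < q → xs [ p ]= x → xs [ q ]= y → R x y)
  → AllPairs R xs
allPairs-[]= []       _ = []
allPairs-[]= (x ∷ xs) h =
  all-[]= xs (h (s≤s z≤n) here ∘ there) ∷ allPairs-[]= xs (λ p<q a b → h (s≤s p<q) (there a) (there b))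

take-[]= : ∀ k xs → take k xs [ p ]= x → p < k × xs [ p ]= x
take-[]= (suc k) (x ∷ xs) here      = s≤s z≤n , here
take-[]= (suc k) (x ∷ xs) (there a) = Product.map s≤s there (take-[]= k xs a)

drop-[]= : ∀ k xs → drop k xs [ p ]= x → xs [ k + p ]= x
drop-[]= zero    xs       a = a
drop-[]= (suc k) (x ∷ xs) a = there (drop-[]= k xs a)

tabulate-[]=⁺ : ∀ {n} (f : Fin n → A) i → tabulate f [ toℕ i ]= f i
tabulate-[]=⁺ f F.zero    = here
tabulate-[]=⁺ f (F.suc i) = there (tabulate-[]=⁺ (f ∘ F.suc) i)

tabulate-[]=⁻ : ∀ {n} (f : Fin n → A) → tabulate f [ p ]= x → ∃ λ i → toℕ i ≡ p × f i ≡ x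
tabulate-[]=⁻ {n = suc n} f here = F.zero , refl , refl
tabulate-[]=⁻ {n = suc n} f (there a) with tabulate-[]=⁻ (f ∘ F.suc) a
... | i , refl , fi≡x = F.suc i , refl , fi≡x

length-∷ʳ-+ : ∀ (xs : List A) x n → length (xs ∷ʳ x) + n ≡ length xs + suc n
length-∷ʳ-+ xs x n = trans (cong (_+ n) (length-++ xs)) (+-assoc (length xs) 1 n)

module _ {R : A → A → Set} (asym : Asymmetric R) where

  allPairs-≡ : AllPairs R xs → AllPairs R ys → xs ⊆ ys → ys ⊆ xs → xs ≡ ys
  allPairs-≡ {[]}     {[]}     _ _ _ _ = refl
  allPairs-≡ {[]}     {y ∷ ys} _ _ _ ys⊆xs with () ← ys⊆xs (here refl)
  allPairs-≡ {x ∷ xs} {[]}     _ _ xs⊆ys _ with () ← xs⊆ys (here refl)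
  allPairs-≡ {x ∷ xs} {y ∷ ys} (x<xs ∷ sorted-xs) (y<ys ∷ sorted-ys) xs⊆ys ys⊆xs =
    cong₂ _∷_ x≡y (allPairs-≡ sorted-xs sorted-ys tail⊆ tail⊇)
    where
    x≡y : x ≡ y
    x≡y with xs⊆ys (here refl) | ys⊆xs (here refl)
    ... | here x≡y  | _         = x≡y
    ... | there _   | here y≡x  = sym y≡x
    ... | there x∈ys | there y∈xs = ⊥-elim (asym (All.lookup x<xs y∈xs) (All.lookup y<ys x∈ys))
    irrefl : {B : Set} → R y y → B
    irrefl r = ⊥-elim (asym r r)
    tail⊆ : xs ⊆ ys
    tail⊆ z∈xs with xs⊆ys (there z∈xs)
    ... | here refl = irrefl (subst (λ v → R v _) x≡y (All.lookup x<xs z∈xs))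
    ... | there z∈ys = z∈ys
    tail⊇ : ys ⊆ xs
    tail⊇ z∈ys with ys⊆xs (there z∈ys)
    ... | here refl = irrefl (subst (R y) x≡y (All.lookup y<ys z∈ys))
    ... | there z∈xs = z∈xs

  -- xs and ys are the two halves of the partition of zs by membership in xs.
  interleaving-of-sorted : DecidableEquality A
    → AllPairs R xs → AllPairs R ys → AllPairs R zs
    → xs ⊆ zs → ys ⊆ zs → Disjoint xs ys → zs ⊆ xs ++ ys
    → Interleaving xs ys zs
  interleaving-of-sorted {xs} {ys} {zs} _≟_ sorted-xs sorted-ys sorted-zs xs⊆zs ys⊆zs disjoint zs⊆xs++ys =
    subst₂ (λ l r → Interleaving l r zs) (sym xs≡) (sym ys≡) (Interleaving.filter⁺ (_∈? xs) zs)
    where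
    open import Data.List.Membership.DecPropositional _≟_ using (_∈?_)
    xs≡ : xs ≡ filter (_∈? xs) zs
    xs≡ = allPairs-≡ sorted-xs (AllPairs.filter⁺ (_∈? xs) sorted-zs)
      (λ z∈xs → ∈-filter⁺ (_∈? xs) (xs⊆zs z∈xs) z∈xs)
      (proj₂ ∘ ∈-filter⁻ (_∈? xs) {xs = zs})
    ys≡ : ys ≡ filter (¬? ∘ (_∈? xs)) zs
    ys≡ = allPairs-≡ sorted-ys (AllPairs.filter⁺ (¬? ∘ (_∈? xs)) sorted-zs)
      (λ z∈ys → ∈-filter⁺ (¬? ∘ (_∈? xs)) (ys⊆zs z∈ys) (λ z∈xs → disjoint (z∈xs , z∈ys)))
      (λ z∈filter → let z∈zs , z∉xs = ∈-filter⁻ (¬? ∘ (_∈? xs)) {xs = zs} z∈filter in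
        Sum.[ (λ z∈xs → ⊥-elim (z∉xs z∈xs)) , id ] (∈-++⁻ xs (zs⊆xs++ys z∈zs)))

∈[]⇒bounds : p ≤ q → z ∈[ p , q ] → p ≤ z × z ≤ q
∈[]⇒bounds p≤q (inj₁ bounds)       = bounds
∈[]⇒bounds p≤q (inj₂ (q≤z , z≤p)) = ≤-trans p≤q q≤z , ≤-trans z≤p p≤q

⊓⊔⇒∈[] : p ⊓ q ≤ z → z ≤ p ⊔ q → z ∈[ p , q ]
⊓⊔⇒∈[] {p} {q} lo hi with ≤-total p q
... | inj₁ p≤q = inj₁ (subst (_≤ _) (m≤n⇒m⊓n≡m p≤q) lo , subst (_ ≤_) (m≤n⇒m⊔n≡n p≤q) hi)
... | inj₂ q≤p = inj₂ (subst (_≤ _) (m≥n⇒m⊓n≡n q≤p) lo , subst (_ ≤_) (m≥n⇒m⊔n≡m q≤p) hi)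

-- Each interval reaches past the other's left end, so the larger of the two left ends lies in both.
intervals-cross : ∀ {a a' b b'} → a < b → b' < a' → ∃ λ q → q ∈[ a , a' ] × q ∈[ b , b' ]
intervals-cross {a} {a'} {b} {b'} a<b b'<a' =
  (a ⊓ a') ⊔ (b ⊓ b') ,
  ⊓⊔⇒∈[] (m≤m⊔n _ _) (⊔-lub (m⊓n≤m⊔n a a') (≤-trans (m⊓n≤n b b') (≤-trans (<⇒≤ b'<a') (m≤n⊔m a a')))) ,
  ⊓⊔⇒∈[] (m≤n⊔m _ _) (⊔-lub (≤-trans (m⊓n≤m a a') (≤-trans (<⇒≤ a<b) (m≤m⊔n b b'))) (m⊓n≤m⊔n b b'))

crossing-point-bounds : ∀ {a b c k} → c + suc k ≡ suc a + suc b + 1 → suc b ≤ c → c ≤ suc a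
  → b < k × k ≤ suc a
crossing-point-bounds {a} {b} {c} {k} c+k≡ b<c c≤a =
  s≤s⁻¹ (+-cancelˡ-≤ (suc a) (suc (suc b)) (suc k) (begin
    suc a + suc (suc b)  ≡⟨ rearrangeˡ a b ⟩
    suc a + suc b + 1    ≡⟨ sym c+k≡ ⟩
    c + suc k            ≤⟨ +-monoˡ-≤ (suc k) c≤a ⟩
    suc a + suc k        ∎)) ,
  s≤s⁻¹ (+-cancelˡ-≤ (suc b) (suc k) (suc (suc a)) (begin
    suc b + suc k        ≤⟨ +-monoˡ-≤ (suc k) b<c ⟩
    c + suc k            ≡⟨ c+k≡ ⟩
    suc a + suc b + 1    ≡⟨ rearrangeʳ a b ⟩
    suc b + suc (suc a)  ∎))
  where
  open ≤-Reasoning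
  rearrangeˡ : ∀ a b → suc a + suc (suc b) ≡ suc a + suc b + 1
  rearrangeˡ = solve-∀
  rearrangeʳ : ∀ a b → suc a + suc b + 1 ≡ suc b + suc (suc a)
  rearrangeʳ = solve-∀

crossing-point-position : ∀ {c k i j} → c + suc k ≡ suc (k + i) + suc j + 1 → c ≡ suc (suc (i + j))
crossing-point-position {c} {k} {i} {j} c+k≡ = +-cancelʳ-≡ (suc k) c _ (trans c+k≡ (rearrange k i j))
  where
  rearrange : ∀ k i j → suc (k + i) + suc j + 1 ≡ suc (suc (i + j)) + suc k
  rearrange = solve-∀

reachable-cong : ∀ {m} {P : Pref (suc m)} {σ τ} → Reachable P σ → (∀ i → σ ⟨$⟩ʳ i ≡ τ ⟨$⟩ʳ i)
  → Reachable P τ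
reachable-cong (initial σ σ≡id) σ≗τ = initial _ (λ i → trans (sym (σ≗τ i)) (σ≡id i))
reachable-cong (step ρ σ ρ-reachable (j , pref₁ , pref₂ , σ≡)) σ≗τ =
  step ρ _ ρ-reachable (j , pref₁ , pref₂ , λ i → trans (sym (σ≗τ i)) (σ≡ i))

module ReachableLists {m : ℕ} (P : Pref (suc m)) where

  Enumerates : List (Fin (suc m)) → Assignment (suc m) → Set
  Enumerates l σ = ∀ i → l [ toℕ i ]= σ ⟨$⟩ʳ i

  ReachableList : List (Fin (suc m)) → Set
  ReachableList l = length l ≡ suc m × ∃ λ σ → Reachable P σ × Enumerates l σ

  Swappable : ℕ → Fin (suc m) → Fin (suc m) → Set
  Swappable d x y = (∀ q → toℕ q ≡ d → prefers P q y x) × (∀ q → toℕ q ≡ suc d → prefers P q x y)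

  Swappable-reindex : ∀ {d d' x y} → d ≡ d' → Swappable d x y → Swappable d' x y
  Swappable-reindex refl s = s

  []=-transpose : ∀ pre {x y rest} (j : Fin m) → toℕ j ≡ length pre
    → ∀ (i : Fin (suc m)) {z : Fin (suc m)}
    → (pre ++ x ∷ y ∷ rest) [ toℕ (transpose (inject₁ j) (F.suc j) ⟨$⟩ʳ i) ]= z
    → (pre ++ y ∷ x ∷ rest) [ toℕ i ]= z
  []=-transpose pre j j≡d i a with i ≟ inject₁ j
  ... | yes refl =
    []=-cong (sym ij≡d) ([]=-functional ([]=-++-∷-∷ pre) ([]=-cong (cong suc j≡d) refl a)) ([]=-++-∷ pre)
    where ij≡d = trans (F.toℕ-inject₁ j) j≡d
  ... | no i≢j with i ≟ F.suc j
  ...   | yes refl =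
    []=-cong (cong suc (sym j≡d)) ([]=-functional ([]=-++-∷ pre) ([]=-cong ij≡d refl a)) ([]=-++-∷-∷ pre)
    where ij≡d = trans (F.toℕ-inject₁ j) j≡d
  ...   | no i≢sj = []=-swap-other pre a
    (λ i≡d → i≢j (F.toℕ-injective (trans i≡d (sym (trans (F.toℕ-inject₁ j) j≡d)))))
    (λ i≡d+1 → i≢sj (F.toℕ-injective (trans i≡d+1 (cong suc (sym j≡d)))))

  reachable-swap : ∀ pre {x y} rest → ReachableList (pre ++ x ∷ y ∷ rest) → Swappable (length pre) x y
    → ReachableList (pre ++ y ∷ x ∷ rest)
  reachable-swap pre {x} {y} rest (len , σ , σ-reachable , enum) (prefer-y , prefer-x) =
    trans (length-++ pre) (trans (sym (length-++ pre)) len) ,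
    τ , step σ τ σ-reachable (j , σ-prefer-y , σ-prefer-x , λ _ → refl) ,
    λ i → []=-transpose pre j j≡d i (enum (transpose (inject₁ j) (F.suc j) ⟨$⟩ʳ i))
    where
    d<m : length pre < m
    d<m = s<s⁻¹ (subst (suc (length pre) <_) len ([]=⇒< ([]=-++-∷-∷ pre)))
    j : Fin m
    j = fromℕ< d<m
    j≡d : toℕ j ≡ length pre
    j≡d = F.toℕ-fromℕ< d<m
    τ : Assignment (suc m)
    τ = transpose (inject₁ j) (F.suc j) ∘ₚ σ
    ij≡d : toℕ (inject₁ j) ≡ length pre
    ij≡d = trans (F.toℕ-inject₁ j) j≡d
    σ-ij≡x : σ ⟨$⟩ʳ inject₁ j ≡ x
    σ-ij≡x = []=-functional ([]=-cong ij≡d refl (enum (inject₁ j))) ([]=-++-∷ pre)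
    σ-sj≡y : σ ⟨$⟩ʳ F.suc j ≡ y
    σ-sj≡y = []=-functional ([]=-cong (cong suc j≡d) refl (enum (F.suc j))) ([]=-++-∷-∷ pre)
    σ-prefer-y : prefers P (inject₁ j) (σ ⟨$⟩ʳ F.suc j) (σ ⟨$⟩ʳ inject₁ j)
    σ-prefer-y = subst₂ (prefers P (inject₁ j)) (sym σ-sj≡y) (sym σ-ij≡x) (prefer-y (inject₁ j) ij≡d)
    σ-prefer-x : prefers P (F.suc j) (σ ⟨$⟩ʳ inject₁ j) (σ ⟨$⟩ʳ F.suc j)
    σ-prefer-x = subst₂ (prefers P (F.suc j)) (sym σ-ij≡x) (sym σ-sj≡y) (prefer-x (F.suc j) (cong suc j≡d))

  bubble-right : ∀ pre x C {rest} → ReachableList (pre ++ x ∷ C ++ rest)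
    → (∀ {j y} → C [ j ]= y → Swappable (length pre + j) x y)
    → ReachableList (pre ++ C ++ x ∷ rest)
  bubble-right pre x []      r _         = r
  bubble-right pre x (y ∷ C) {rest} r swappable =
    subst ReachableList (∷ʳ-++ pre y _)
      (bubble-right (pre ∷ʳ y) x C (subst ReachableList (sym (∷ʳ-++ pre y _)) swapped) swappable-later)
    where
    swapped : ReachableList (pre ++ y ∷ x ∷ C ++ rest)
    swapped = reachable-swap pre (C ++ rest) r (Swappable-reindex (+-identityʳ _) (swappable here))
    swappable-later : ∀ {j z} → C [ j ]= z → Swappable (length (pre ∷ʳ y) + j) x z
    swappable-later {j} c = Swappable-reindex (sym (length-∷ʳ-+ pre y j)) (swappable (there c))

  -- Each element of ys moves right past the elements of xs after it in zs, all larger than it;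
  -- the i-th element of ys and the j-th of xs are exchanged at positions i + j, i + j + 1 after pre.
  reachable-interleaving : ∀ pre {xs ys zs} → Interleaving xs ys zs → AllPairs F._<_ zs
    → ReachableList (pre ++ zs)
    → (∀ {i j x y} → ys [ i ]= x → xs [ j ]= y → x F.< y → Swappable (length pre + (i + j)) x y)
    → ReachableList (pre ++ xs ++ ys)
  reachable-interleaving pre []        _ r _ = r
  reachable-interleaving pre {a ∷ xs} {ys} (consˡ I) (_ ∷ sorted) r swappable =
    subst ReachableList (∷ʳ-++ pre a _)
      (reachable-interleaving (pre ∷ʳ a) I sorted (subst ReachableList (sym (∷ʳ-++ pre a _)) r) swappable-later)
    where
    swappable-later : ∀ {i j x y} → ys [ i ]= x → xs [ j ]= y → x F.< y
      → Swappable (length (pre ∷ʳ a) + (i + j)) x y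
    swappable-later {i} {j} ys-i xs-j x<y =
      Swappable-reindex (sym (trans (length-∷ʳ-+ pre a (i + j)) (cong (length pre +_) (sym (+-suc i j)))))
        (swappable ys-i (there xs-j) x<y)
  reachable-interleaving pre {xs} {b ∷ ys} (consʳ I) (b<zs ∷ sorted) r swappable =
    bubble-right pre b xs
      (subst ReachableList (∷ʳ-++ pre b _)
        (reachable-interleaving (pre ∷ʳ b) I sorted (subst ReachableList (sym (∷ʳ-++ pre b _)) r) swappable-later))
      (λ c → swappable here c (All.lookup b<zs (∈-resp-↭ (↭-sym (toPermutation I)) (∈-++⁺ˡ ([]=⇒∈ c)))))
    where
    swappable-later : ∀ {i j x y} → ys [ i ]= x → xs [ j ]= y → x F.< y
      → Swappable (length (pre ∷ʳ b) + (i + j)) x y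
    swappable-later {i} {j} ys-i xs-j x<y =
      Swappable-reindex (sym (length-∷ʳ-+ pre b (i + j))) (swappable (there ys-i) xs-j x<y)

module Compatible⇒Reachable {m : ℕ} (P : Pref (suc m)) (σ : Assignment (suc m)) (K : ℕ)
  (holder-of-last : idx (σ ⟨$⟩ˡ fromℕ m) ≡ K) (compatible : Compatible P σ (suc K)) where
  open ReachableLists P

  held : List (Fin (suc m))
  held = tabulate (σ ⟨$⟩ʳ_)

  front back : List (Fin (suc m))
  front = take K held
  back  = drop K held

  held-[]= : held [ p ]= x → toℕ (σ ⟨$⟩ˡ x) ≡ p
  held-[]= a with i , refl , refl ← tabulate-[]=⁻ (σ ⟨$⟩ʳ_) a = cong toℕ (inverseˡ σ)

  front-[]= : front [ p ]= x → p < K × toℕ (σ ⟨$⟩ˡ x) ≡ p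
  front-[]= = map₂ held-[]= ∘ take-[]= K held

  back-[]= : back [ p ]= x → toℕ (σ ⟨$⟩ˡ x) ≡ K + p
  back-[]= = held-[]= ∘ drop-[]= K held

  inversion-cond3 : ∀ {oa ob} → toℕ oa < toℕ ob → toℕ (σ ⟨$⟩ˡ ob) < toℕ (σ ⟨$⟩ˡ oa)
    → Cond3 P σ (suc K) oa ob
  inversion-cond3 {oa} {ob} a<b b'<a' with proj₂ compatible oa ob a<b
  ... | inj₁ not-intersected = ⊥-elim (not-intersected (intervals-cross (s≤s a<b) (s≤s b'<a')))
  ... | inj₂ (_ , inj₁ (_ , _ , a'<b' , _))         = ⊥-elim (<-asym a'<b' (s≤s b'<a'))
  ... | inj₂ (_ , inj₂ (inj₁ (_ , _ , a'<b' , _)))  = ⊥-elim (<-asym a'<b' (s≤s b'<a'))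
  ... | inj₂ (_ , inj₂ (inj₂ cond3))                = cond3

  inversion-straddles : ∀ {oa ob} → toℕ oa < toℕ ob → toℕ (σ ⟨$⟩ˡ ob) < toℕ (σ ⟨$⟩ˡ oa)
    → toℕ (σ ⟨$⟩ˡ ob) < K × K ≤ suc (toℕ (σ ⟨$⟩ˡ oa))
  inversion-straddles a<b b'<a' with inversion-cond3 a<b b'<a'
  ... | a<a' , b'<b , c , c+k≡ , (c∈[a,a'] , c∈[b,b']) , _ =
    crossing-point-bounds c+k≡
      (proj₁ (∈[]⇒bounds (<⇒≤ b'<b) (Sum.swap c∈[b,b'])))
      (proj₂ (∈[]⇒bounds (<⇒≤ a<a') c∈[a,a']))

  ordered-or-straddling : toℕ (σ ⟨$⟩ˡ x) < toℕ (σ ⟨$⟩ˡ y)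
    → x F.< y ⊎ (y F.< x × toℕ (σ ⟨$⟩ˡ x) < K × K ≤ suc (toℕ (σ ⟨$⟩ˡ y)))
  ordered-or-straddling {x} {y} x'<y' with F.<-cmp x y
  ... | tri< x<y _ _  = inj₁ x<y
  ... | tri≈ _ refl _ = ⊥-elim (<-irrefl refl x'<y')
  ... | tri> _ _ y<x  = inj₂ (y<x , inversion-straddles y<x x'<y')

  held-by-last-front-agent : suc (toℕ (σ ⟨$⟩ˡ y)) ≡ K → y ≡ fromℕ m
  held-by-last-front-agent {y} y'≡ = begin
    y                         ≡⟨ sym (inverseʳ σ) ⟩
    σ ⟨$⟩ʳ (σ ⟨$⟩ˡ y)         ≡⟨ cong (σ ⟨$⟩ʳ_) (F.toℕ-injective (suc-injective (trans y'≡ (sym holder-of-last)))) ⟩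
    σ ⟨$⟩ʳ (σ ⟨$⟩ˡ fromℕ m)  ≡⟨ inverseʳ σ ⟩
    fromℕ m                   ∎
    where open ≡-Reasoning

  front-sorted : AllPairs F._<_ front
  front-sorted = allPairs-[]= front sorted
    where
    sorted : p < q → front [ p ]= x → front [ q ]= y → x F.< y
    sorted {x = x} p<q fx fy with front-[]= fx | front-[]= fy
    ... | _ , x'≡p | q<K , y'≡q with ordered-or-straddling (subst₂ _<_ (sym x'≡p) (sym y'≡q) p<q)
    ...   | inj₁ x<y                = x<y
    ...   | inj₂ (y<x , _ , K≤y'+1) =
      ⊥-elim (<⇒≱ y<x (subst (λ v → toℕ x ≤ toℕ v) (sym y≡last) (F.≤fromℕ x)))
      where
      y≡last = held-by-last-front-agent (≤-antisym (subst (λ v → suc v ≤ K) (sym y'≡q) q<K) K≤y'+1)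

  back-sorted : AllPairs F._<_ back
  back-sorted = allPairs-[]= back sorted
    where
    sorted : p < q → back [ p ]= x → back [ q ]= y → x F.< y
    sorted {p} p<q bx by
      with ordered-or-straddling (subst₂ _<_ (sym (back-[]= bx)) (sym (back-[]= by)) (+-monoʳ-< K p<q))
    ... | inj₁ x<y              = x<y
    ... | inj₂ (_ , x'<K , _)   = ⊥-elim (m+n≮m K p (subst (_< K) (back-[]= bx) x'<K))

  -- The crossing point c of Cond3 is i + j + 2, the 1-based index of the agent at position i + j + 1.
  cond3⇒swappable : ∀ {i j x y} → toℕ (σ ⟨$⟩ˡ x) ≡ K + i → toℕ (σ ⟨$⟩ˡ y) ≡ j
    → Cond3 P σ (suc K) x y → Swappable (i + j) x y
  cond3⇒swappable {i} {j} {x} {y} x'≡ y'≡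
    (a<a' , b'<b , c , c+k≡ , (c∈[a,a'] , c∈[b,b']) , c≢a , prefer-y , prefer-x) =
    (λ q q≡ → prefer-y q (⊔-lub (a≤ q≡) (b'≤ q≡)) (subst (idx q <_) (sym (c≡1+ q≡)) (n<1+n _))) ,
    (λ q q≡ → let q≡c = trans (cong suc q≡) (sym c≡) in
      prefer-x q (≤-reflexive (sym q≡c)) (subst (_≤ _) (sym q≡c) (⊓-glb c≤a' c≤b)))
    where
    c≡ : c ≡ suc (suc (i + j))
    c≡ = crossing-point-position (trans c+k≡ (cong₂ (λ u v → suc u + suc v + 1) x'≡ y'≡))
    a≤c = proj₁ (∈[]⇒bounds (<⇒≤ a<a') c∈[a,a'])
    c≤a' = proj₂ (∈[]⇒bounds (<⇒≤ a<a') c∈[a,a'])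
    c≤b = proj₂ (∈[]⇒bounds (<⇒≤ b'<b) (Sum.swap c∈[b,b']))
    c≡1+ : ∀ {q} → toℕ q ≡ i + j → c ≡ suc (idx q)
    c≡1+ q≡ = trans c≡ (cong (suc ∘ suc) (sym q≡))
    a≤ : ∀ {q} → toℕ q ≡ i + j → idx x ≤ idx q
    a≤ q≡ = s≤s⁻¹ (subst (idx x <_) (c≡1+ q≡) (≤∧≢⇒< a≤c (c≢a ∘ sym)))
    b'≤ : ∀ {q} → toℕ q ≡ i + j → idx (σ ⟨$⟩ˡ y) ≤ idx q
    b'≤ q≡ = subst₂ _≤_ (cong suc (sym y'≡)) (cong suc (sym q≡)) (s≤s (m≤n+m j i))

  crossing-swappable : ∀ {i j x y} → back [ i ]= x → front [ j ]= y → x F.< y → Swappable (i + j) x y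
  crossing-swappable {i} bx fy x<y with j<K , y'≡j ← front-[]= fy =
    cond3⇒swappable (back-[]= bx) y'≡j
      (inversion-cond3 x<y (subst₂ _<_ (sym y'≡j) (sym (back-[]= bx)) (<-≤-trans j<K (m≤m+n K i))))

  held-covers : allFin (suc m) ⊆ front ++ back
  held-covers {z} _ =
    subst (z ∈_) (sym (take++drop≡id K held))
      (subst (_∈ held) (inverseʳ σ) (∈-tabulate⁺ {f = σ ⟨$⟩ʳ_} (σ ⟨$⟩ˡ z)))

  front-back-disjoint : Disjoint front back
  front-back-disjoint (z∈front , z∈back) =
    let _ , fz = ∈⇒[]= z∈front
        q , bz = ∈⇒[]= z∈back
        p<K , z'≡p = front-[]= fz
    in m+n≮m K q (subst (_< K) (trans (sym z'≡p) (back-[]= bz)) p<K)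

  start : ReachableList (allFin (suc m))
  start = length-tabulate id , Perm.id , initial Perm.id (λ _ → refl) , tabulate-[]=⁺ id

  reachable : Reachable P σ
  reachable with _ , τ , τ-reachable , τ-enumerates ←
    reachable-interleaving []
      (interleaving-of-sorted F.<-asym _≟_ front-sorted back-sorted (AllPairs.tabulate⁺-< id)
        (λ {z} _ → ∈-allFin z) (λ {z} _ → ∈-allFin z) front-back-disjoint held-covers)
      (AllPairs.tabulate⁺-< id) start crossing-swappable
    = reachable-cong τ-reachable (λ i → []=-functional (τ-enumerates i)
        (subst (_[ toℕ i ]= σ ⟨$⟩ʳ i) (sym (take++drop≡id K held)) (tabulate-[]=⁺ (σ ⟨$⟩ʳ_) i)))

lemma11 : (m : ℕ) (P : Pref (suc m)) (σ : Assignment (suc m)) (k : ℕ)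
    → 2 ≤ k → k ≤ suc m
    → idx (σ ⟨$⟩ˡ zero) ≡ k
    → idx (σ ⟨$⟩ˡ fromℕ m) ≡ k ∸ 1
    → Compatible P σ k
    → Reachable P σ
lemma11 m P σ (suc (suc k)) (s≤s (s≤s z≤n)) _ _ holder-of-last compatible =
  Compatible⇒Reachable.reachable P σ (suc k) holder-of-last compatible
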